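{- (1) Let $R$ be an enf simulation. If $t\,R\,t'$ and there is a multi type derivation of $\Gamma\vdash t:M$, then there is a derivation of $\Gamma\vdash t':M$. (2) If $t\precsim_{enf}t'$ then $t\precsim_{type}t'$.
   Context: Plotkin terms: $t::=v\mid tu$, values $v::=x\mid\lambda x.t$ (these are VSC terms without explicit substitutions). Root rule $(\lambda x.t)v\mapsto t\{x:=v\}$ ($v$ a value). Left contexts $L::=\langle\cdot\rangle\mid vL\mid Lt$ ($v$ a value); left reduction $\to_l$ is the closure of the root rule under left contexts. $t\Downarrow_l n$ means $t\to_l^*n$ with $n$ $\to_l$-normal. Every $\to_l$-normal form is either a value or of the form $L\langle xv\rangle$. Enf simulation: a relation $R$ on Plotkin terms such that whenever $tRt'$ one of: $t$ has no $\to_l$-normal form; $t\Downarrow_lx$ and $t'\Downarrow_lx$; $t\Downarrow_l\lambda x.t_1$, $t'\Downarrow_l\lambda x.t_1'$ with $t_1Rt_1'$; $t\Downarrow_lL\langle xv\rangle$ and $t'\Downarrow_lL'\langle xv'\rangle$ with $vRv'$ and $L\langle z\rangle RL'\langle z\rangle$ for $z$ not free in $L,L'$. Enf similarity $\precsim_{enf}$ is the largest enf simulation. Multi types: linear $L::=M\multimap N$; multi $M,N::=[L_1,\dots,L_n]$ ($n\ge0$, finite multisets, $\uplus$ union); typing contexts assign multi types to finitely many variables (others $[\,]$), $\uplus$ pointwise. Rules (on terms $t::=v\mid tu\mid t[x\leftarrow u]$ with explicit substitutions): $x:[L]\vdash x:L$; $\Gamma,x:M\vdash t:N\Rightarrow\Gamma\vdash\lambda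 x.t:M\multimap N$; $(\Gamma_i\vdash v:L_i)_{i\in I}$, $I$ finite $\Rightarrow\uplus_i\Gamma_i\vdash v:\uplus_i[L_i]$; $\Gamma\vdash t:[M\multimap N]$, $\Delta\vdash u:M\Rightarrow\Gamma\uplus\Delta\vdash tu:N$; $\Gamma,x:M\vdash t:N$, $\Delta\vdash u:M\Rightarrow\Gamma\uplus\Delta\vdash t[x\leftarrow u]:N$. Type preorder: $t\precsim_{type}t'$ iff for all $\Gamma$ and multi types $M$, derivability of $\Gamma\vdash t:M$ implies derivability of $\Gamma\vdash t':M$. -}

module Defs where

open import Data.Nat using (ℕ; zero; suc)
open import Data.List using (List; []; _∷_; _++_; map; [_])
open import Data.List.Relation.Unary.All using (All)
open import Data.Product using (Σ; ∃; _×_; _,_; proj₁; proj₂)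
open import Data.Sum using (_⊎_)
open import Relation.Binary.PropositionalEquality using (_≡_; _≢_)
open import Relation.Binary.Construct.Closure.ReflexiveTransitive using (Star)
open import Relation.Nullary using (¬_)

-- Plotkin terms (de Bruijn indices; lam binds index 0)

data PTm : Set where
  var : ℕ → PTm
  lam : PTm → PTm
  app : PTm → PTm → PTm

data IsVal : PTm → Set where
  var : ∀ x → IsVal (var x)
  lam : ∀ t → IsVal (lam t)

ext : (ℕ → ℕ) → ℕ → ℕ
ext ρ zero    = zero
ext ρ (suc x) = suc (ρ x)

rename : (ℕ → ℕ) → PTm → PTm
rename ρ (var x)   = var (ρ x)
rename ρ (lam t)   = lam (rename (ext ρ) t)
rename ρ (app t u) = app (rename ρ t) (rename ρ u)

exts : (ℕ → PTm) → ℕ → PTm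
exts σ zero    = var zero
exts σ (suc x) = rename suc (σ x)

subst : (ℕ → PTm) → PTm → PTm
subst σ (var x)   = σ x
subst σ (lam t)   = lam (subst (exts σ) t)
subst σ (app t u) = app (subst σ t) (subst σ u)

-- t{0 := v}  (free indices ≥ 1 of t are decremented)
sub0 : PTm → ℕ → PTm
sub0 v zero    = v
sub0 v (suc x) = var x

_⟦_⟧ : PTm → PTm → PTm
t ⟦ v ⟧ = subst (sub0 v) t

data Occurs : ℕ → PTm → Set where
  var  : ∀ x → Occurs x (var x)
  lam  : ∀ {x t} → Occurs (suc x) t → Occurs x (lam t)
  appl : ∀ {x t u} → Occurs x t → Occurs x (app t u)
  appr : ∀ {x t u} → Occurs x u → Occurs x (app t u)

data LCtx : Set where
  hole : LCtx
  vL   : (v : PTm) → IsVal v → LCtx → LCtx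
  Lt   : LCtx → PTm → LCtx

plug : LCtx → PTm → PTm
plug hole       s = s
plug (vL v _ L) s = app v (plug L s)
plug (Lt L t)   s = app (plug L s) t

data OccursL : ℕ → LCtx → Set where
  vLv : ∀ {x v p L} → Occurs x v → OccursL x (vL v p L)
  vLL : ∀ {x v p L} → OccursL x L → OccursL x (vL v p L)
  LtL : ∀ {x L t} → OccursL x L → OccursL x (Lt L t)
  Ltt : ∀ {x L t} → Occurs x t → OccursL x (Lt L t)

data _→l_ : PTm → PTm → Set where
  left : ∀ (L : LCtx) {t v} → IsVal v →
         plug L (app (lam t) v) →l plug L (t ⟦ v ⟧)

Normal : PTm → Set
Normal t = ∀ t' → ¬ (t →l t')

_⇓l_ : PTm → PTm → Set
t ⇓l n = Star _→l_ t n × Normal n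

IsEnfSim : (PTm → PTm → Set) → Set
IsEnfSim R = ∀ t t' → R t t' →
    (¬ ∃ λ n → t ⇓l n)
  ⊎ (∃ λ x → t ⇓l var x × t' ⇓l var x)
  ⊎ (∃ λ t₁ → ∃ λ t₁' → t ⇓l lam t₁ × t' ⇓l lam t₁' × R t₁ t₁')
  ⊎ (∃ λ L → ∃ λ L' → ∃ λ x → ∃ λ v → ∃ λ v' →
       IsVal v × IsVal v' ×
       t ⇓l plug L (app (var x) v) × t' ⇓l plug L' (app (var x) v') ×
       R v v' ×
       ∃ λ z → ¬ OccursL z L × ¬ OccursL z L' × R (plug L (var z)) (plug L' (var z)))

-- the largest enf simulation = union of all enf simulations
_≾enf_ : PTm → PTm → Set₁
t ≾enf t' = ∃ λ (R : PTm → PTm → Set) → IsEnfSim R × R t t'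

-- Terms with explicit substitutions (es t u = t[0 ← u], binding 0 in t)

data Tm : Set where
  var : ℕ → Tm
  lam : Tm → Tm
  app : Tm → Tm → Tm
  es  : Tm → Tm → Tm

data IsValT : Tm → Set where
  var : ∀ x → IsValT (var x)
  lam : ∀ t → IsValT (lam t)

⌜_⌝ : PTm → Tm
⌜ var x ⌝   = var x
⌜ lam t ⌝   = lam ⌜ t ⌝
⌜ app t u ⌝ = app ⌜ t ⌝ ⌜ u ⌝

-- Multi types; finite multisets are lists taken up to permutation

data Lin : Set where
  _⊸_ : List Lin → List Lin → Lin

Multi : Set
Multi = List Lin

data _≈ᴸ_ : Lin → Lin → Set
data _≈ᴹ_ : Multi → Multi → Set

data _≈ᴸ_ where
  ⊸-cong : ∀ {M M' N N'} → M ≈ᴹ M' → N ≈ᴹ N' → (M ⊸ N) ≈ᴸ (M' ⊸ N')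

data _≈ᴹ_ where
  []    : [] ≈ᴹ []
  _∷_   : ∀ {L L' M M'} → L ≈ᴸ L' → M ≈ᴹ M' → (L ∷ M) ≈ᴹ (L' ∷ M')
  swap  : ∀ {L L' M} → (L ∷ L' ∷ M) ≈ᴹ (L' ∷ L ∷ M)
  trans : ∀ {M M' M''} → M ≈ᴹ M' → M' ≈ᴹ M'' → M ≈ᴹ M''

Ctx : Set
Ctx = ℕ → Multi

_≈ᶜ_ : Ctx → Ctx → Set
Γ ≈ᶜ Δ = ∀ i → Γ i ≈ᴹ Δ i

_⊎ᶜ_ : Ctx → Ctx → Ctx
(Γ ⊎ᶜ Δ) i = Γ i ++ Δ i

⨄ : List Ctx → Ctx
⨄ []       i = []
⨄ (Γ ∷ Γs) i = Γ i ++ ⨄ Γs i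

-- Γ , x : M  (x = the newly bound index 0)
_∷ᶜ_ : Multi → Ctx → Ctx
(M ∷ᶜ Γ) zero    = M
(M ∷ᶜ Γ) (suc i) = Γ i

data _⊢ₗ_∶_ : Ctx → Tm → Lin → Set
data _⊢_∶_  : Ctx → Tm → Multi → Set

data _⊢ₗ_∶_ where
  ax  : ∀ {Γ x L} → Γ x ≈ᴹ [ L ] → (∀ y → y ≢ x → Γ y ≈ᴹ []) →
        Γ ⊢ₗ var x ∶ L
  abs : ∀ {Γ t M N} → (M ∷ᶜ Γ) ⊢ t ∶ N → Γ ⊢ₗ lam t ∶ (M ⊸ N)

data _⊢_∶_ where
  many : ∀ {Θ v M} → IsValT v → (ds : List (Ctx × Lin)) →
         All (λ d → proj₁ d ⊢ₗ v ∶ proj₂ d) ds →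
         Θ ≈ᶜ ⨄ (map proj₁ ds) → M ≈ᴹ map proj₂ ds →
         Θ ⊢ v ∶ M
  app  : ∀ {Γ Δ Θ t u M N} → Γ ⊢ t ∶ [ M ⊸ N ] → Δ ⊢ u ∶ M →
         Θ ≈ᶜ (Γ ⊎ᶜ Δ) → Θ ⊢ app t u ∶ N
  es   : ∀ {Γ Δ Θ t u M N} → (M ∷ᶜ Γ) ⊢ t ∶ N → Δ ⊢ u ∶ M →
         Θ ≈ᶜ (Γ ⊎ᶜ Δ) → Θ ⊢ es t u ∶ N

_≾type_ : PTm → PTm → Set
t ≾type t' = ∀ (Γ : Ctx) (M : Multi) → Γ ⊢ ⌜ t ⌝ ∶ M → Γ ⊢ ⌜ t' ⌝ ∶ M

-- Derivations are indexed by their number of abs and app rules. Left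
-- reduction strictly decreases this size (substitution lemma for values) and
-- preserves types backwards (anti-substitution), so typable terms
-- left-normalise and typings move freely along left reduction.  Given t R t',
-- reduce both sides to their related normal forms and argue by induction on
-- the size: a derivation of λx.t₁ is made of derivations of t₁, and one of
-- L⟨x v⟩ splits into a derivation of v and one of L⟨z⟩ for a fresh z whose
-- type records the type of the hole.  These smaller derivations transfer to
-- t₁', v' and L'⟨z⟩, and cancelling z in the context of L'⟨z⟩ shows that L'
-- accepts x v' in place of z.  Part (2) is part (1) for a witnessing R.
module Submission where

open import Defs
open import Level using (0ℓ)
open import Algebra.Bundles using (CommutativeMonoid)
import Algebra.Construct.Pointwise as Pointwise
import Algebra.Properties.CommutativeSemigroup as CommutativeSemigroupProperties
open import Data.Product using (_×_; ∃; _,_; proj₁; proj₂)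
open import Data.Nat using (ℕ; zero; suc; _+_; _≤_; _<_; z≤n; s≤s)
open import Data.Nat.Properties using (+-assoc; <-≤-trans; +-identityʳ; ≤-refl; ≤-trans; m≤m+n; m≤n+m; n≤1+n; <⇒≤; +-monoˡ-<; +-monoʳ-<; _≟_; +-commutativeSemigroup)
open import Data.List using (List; []; _∷_; _++_; map; [_]; length)
open import Data.List.Properties using (++-identityʳ; ++-assoc)
open import Data.List.Relation.Unary.All using (All; []; _∷_)
open import Data.Sum using (_⊎_; inj₁; inj₂)
open import Data.Empty using (⊥-elim)
open import Data.Nat.Induction using (<-wellFounded)
open import Induction.WellFounded using (Acc; acc)
open import Relation.Nullary using (¬_; yes; no)
open import Relation.Binary.PropositionalEquality using (_≡_; refl; cong; cong₂; _≢_; _≗_) renaming (sym to ≡-sym; trans to ≡-trans)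
open import Relation.Binary.Construct.Closure.ReflexiveTransitive using (Star; ε; _◅_)

module ℕ+ = CommutativeSemigroupProperties +-commutativeSemigroup

-- Multisets and typing contexts

≈ᴸ-refl : ∀ {L} → L ≈ᴸ L
≈ᴹ-refl : ∀ {M} → M ≈ᴹ M
≈ᴸ-refl {M ⊸ N} = ⊸-cong ≈ᴹ-refl ≈ᴹ-refl
≈ᴹ-refl {[]}    = []
≈ᴹ-refl {L ∷ M} = ≈ᴸ-refl ∷ ≈ᴹ-refl

≈ᴸ-sym : ∀ {L L'} → L ≈ᴸ L' → L' ≈ᴸ L
≈ᴹ-sym : ∀ {M M'} → M ≈ᴹ M' → M' ≈ᴹ M
≈ᴸ-sym (⊸-cong p q) = ⊸-cong (≈ᴹ-sym p) (≈ᴹ-sym q)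
≈ᴹ-sym []          = []
≈ᴹ-sym (p ∷ q)     = ≈ᴸ-sym p ∷ ≈ᴹ-sym q
≈ᴹ-sym swap        = swap
≈ᴹ-sym (trans p q) = trans (≈ᴹ-sym q) (≈ᴹ-sym p)

≈ᴹ-reflexive : ∀ {M N} → M ≡ N → M ≈ᴹ N
≈ᴹ-reflexive refl = ≈ᴹ-refl

++-congˡ : ∀ {M M'} N → M ≈ᴹ M' → (M ++ N) ≈ᴹ (M' ++ N)
++-congˡ N []          = ≈ᴹ-refl
++-congˡ N (p ∷ q)     = p ∷ ++-congˡ N q
++-congˡ N swap        = swap
++-congˡ N (trans p q) = trans (++-congˡ N p) (++-congˡ N q)

++-congʳ : ∀ M {N N'} → N ≈ᴹ N' → (M ++ N) ≈ᴹ (M ++ N')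
++-congʳ []      p = p
++-congʳ (L ∷ M) p = ≈ᴸ-refl ∷ ++-congʳ M p

++-cong : ∀ {M M' N N'} → M ≈ᴹ M' → N ≈ᴹ N' → (M ++ N) ≈ᴹ (M' ++ N')
++-cong {M' = M'} {N = N} p q = trans (++-congˡ N p) (++-congʳ M' q)

≈ᴹ-shift : ∀ L M N → (L ∷ (M ++ N)) ≈ᴹ (M ++ (L ∷ N))
≈ᴹ-shift L []      N = ≈ᴹ-refl
≈ᴹ-shift L (K ∷ M) N = trans swap (≈ᴸ-refl ∷ ≈ᴹ-shift L M N)

++-comm-≈ᴹ : ∀ M N → (M ++ N) ≈ᴹ (N ++ M)
++-comm-≈ᴹ []      N = ≈ᴹ-reflexive (≡-sym (++-identityʳ N))
++-comm-≈ᴹ (L ∷ M) N = trans (≈ᴸ-refl ∷ ++-comm-≈ᴹ M N) (≈ᴹ-shift L N M)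

≈ᴹ-length : ∀ {M N} → M ≈ᴹ N → length M ≡ length N
≈ᴹ-length []          = refl
≈ᴹ-length (p ∷ q)     = cong suc (≈ᴹ-length q)
≈ᴹ-length swap        = refl
≈ᴹ-length (trans p q) = ≡-trans (≈ᴹ-length p) (≈ᴹ-length q)

≈ᴹ[]⇒≡[] : ∀ {M} → M ≈ᴹ [] → M ≡ []
≈ᴹ[]⇒≡[] {[]}    p = refl
≈ᴹ[]⇒≡[] {L ∷ M} p with ≈ᴹ-length p
... | ()

++-≈ᴹ[] : ∀ {M N} → M ≈ᴹ [] → N ≈ᴹ [] → (M ++ N) ≈ᴹ []
++-≈ᴹ[] p q rewrite ≈ᴹ[]⇒≡[] p = q

multisetCommutativeMonoid : CommutativeMonoid 0ℓ 0ℓ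
multisetCommutativeMonoid = record
  { isCommutativeMonoid = record
    { isMonoid = record
      { isSemigroup = record
        { isMagma = record
          { isEquivalence = record { refl = ≈ᴹ-refl ; sym = ≈ᴹ-sym ; trans = trans }
          ; ∙-cong        = ++-cong
          }
        ; assoc = λ M N K → ≈ᴹ-reflexive (++-assoc M N K)
        }
      ; identity = (λ M → ≈ᴹ-refl) , (λ M → ≈ᴹ-reflexive (++-identityʳ M))
      }
    ; comm = ++-comm-≈ᴹ
    }
  }

ctxCommutativeMonoid : CommutativeMonoid 0ℓ 0ℓ
ctxCommutativeMonoid = Pointwise.commutativeMonoid ℕ multisetCommutativeMonoid

open CommutativeMonoid ctxCommutativeMonoid
  using () renaming (refl to ≈ᶜ-refl; sym to ≈ᶜ-sym; trans to ≈ᶜ-trans; ∙-cong to ⊎ᶜ-cong; assoc to ⊎ᶜ-assoc; identityʳ to ⊎ᶜ-identityʳ)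

module Ctx⊎ = CommutativeSemigroupProperties (CommutativeMonoid.commutativeSemigroup ctxCommutativeMonoid)

∅ᶜ : Ctx
∅ᶜ _ = []

tailᶜ : Ctx → Ctx
tailᶜ Γ i = Γ (suc i)

≗⇒≈ᶜ : ∀ {Γ Δ} → Γ ≗ Δ → Γ ≈ᶜ Δ
≗⇒≈ᶜ p i = ≈ᴹ-reflexive (p i)

∷ᶜ-cong : ∀ {M N Γ Δ} → M ≈ᴹ N → Γ ≈ᶜ Δ → (M ∷ᶜ Γ) ≈ᶜ (N ∷ᶜ Δ)
∷ᶜ-cong p q zero    = p
∷ᶜ-cong p q (suc i) = q i

singleᶜ : ℕ → Multi → Ctx
singleᶜ zero    N = N ∷ᶜ ∅ᶜ
singleᶜ (suc x) N = [] ∷ᶜ singleᶜ x N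

singleᶜ-self : ∀ x N → singleᶜ x N x ≡ N
singleᶜ-self zero    N = refl
singleᶜ-self (suc x) N = singleᶜ-self x N

singleᶜ-≢ : ∀ x N {y} → y ≢ x → singleᶜ x N y ≡ []
singleᶜ-≢ zero    N {zero}  y≢x = ⊥-elim (y≢x refl)
singleᶜ-≢ zero    N {suc y} y≢x = refl
singleᶜ-≢ (suc x) N {zero}  y≢x = refl
singleᶜ-≢ (suc x) N {suc y} y≢x = singleᶜ-≢ x N (λ y≡x → y≢x (cong suc y≡x))

singleᶜ-cong : ∀ x {N N'} → N ≈ᴹ N' → singleᶜ x N ≈ᶜ singleᶜ x N'
singleᶜ-cong zero    p = ∷ᶜ-cong p ≈ᶜ-refl
singleᶜ-cong (suc x) p = ∷ᶜ-cong [] (singleᶜ-cong x p)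

singleᶜ-[] : ∀ x → singleᶜ x [] ≗ ∅ᶜ
singleᶜ-[] zero    zero    = refl
singleᶜ-[] zero    (suc i) = refl
singleᶜ-[] (suc x) zero    = refl
singleᶜ-[] (suc x) (suc i) = singleᶜ-[] x i

singleᶜ-++ : ∀ x M N → (singleᶜ x M ⊎ᶜ singleᶜ x N) ≗ singleᶜ x (M ++ N)
singleᶜ-++ zero    M N zero    = refl
singleᶜ-++ zero    M N (suc i) = refl
singleᶜ-++ (suc x) M N zero    = refl
singleᶜ-++ (suc x) M N (suc i) = singleᶜ-++ x M N i

⊎ᶜ-singleᶜ-cancel : ∀ z {Γ Γ' N N'} → (Γ ⊎ᶜ singleᶜ z N) ≈ᶜ (Γ' ⊎ᶜ singleᶜ z N') →
                    Γ z ≈ᴹ [] → Γ' z ≈ᴹ [] → (Γ ≈ᶜ Γ') × (N ≈ᴹ N')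
⊎ᶜ-singleᶜ-cancel z {Γ} {Γ'} {N} {N'} p Γz≈[] Γ'z≈[] = Γ≈Γ' , N≈N'
  where
  N≈N' : N ≈ᴹ N'
  N≈N' = trans (≈ᴹ-reflexive (≡-sym (cong₂ _++_ (≈ᴹ[]⇒≡[] Γz≈[]) (singleᶜ-self z N))))
         (trans (p z) (≈ᴹ-reflexive (cong₂ _++_ (≈ᴹ[]⇒≡[] Γ'z≈[]) (singleᶜ-self z N'))))
  Γ≈Γ' : Γ ≈ᶜ Γ'
  Γ≈Γ' i with i ≟ z
  ... | yes refl = trans Γz≈[] (≈ᴹ-sym Γ'z≈[])
  ... | no i≢z   = trans (≈ᴹ-reflexive (≡-sym (≡-trans (cong (Γ i ++_) (singleᶜ-≢ z N i≢z)) (++-identityʳ (Γ i)))))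
                   (trans (p i) (≈ᴹ-reflexive (≡-trans (cong (Γ' i ++_) (singleᶜ-≢ z N' i≢z)) (++-identityʳ (Γ' i)))))

insertᶜ : ℕ → Multi → Ctx → Ctx
insertᶜ zero    M Γ = M ∷ᶜ Γ
insertᶜ (suc k) M Γ = Γ zero ∷ᶜ insertᶜ k M (tailᶜ Γ)

removeᶜ : ℕ → Ctx → Ctx
removeᶜ zero    Γ = tailᶜ Γ
removeᶜ (suc k) Γ = Γ zero ∷ᶜ removeᶜ k (tailᶜ Γ)

shiftᶜ : ℕ → Ctx → Ctx
shiftᶜ zero    Δ = Δ
shiftᶜ (suc k) Δ = [] ∷ᶜ shiftᶜ k Δ

punchIn : ℕ → ℕ → ℕ
punchIn zero    = suc
punchIn (suc k) = ext (punchIn k)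

insertᶜ-self : ∀ k M Γ → insertᶜ k M Γ k ≡ M
insertᶜ-self zero    M Γ = refl
insertᶜ-self (suc k) M Γ = insertᶜ-self k M (tailᶜ Γ)

insertᶜ-cong : ∀ k {M M' Γ Γ'} → M ≈ᴹ M' → Γ ≈ᶜ Γ' → insertᶜ k M Γ ≈ᶜ insertᶜ k M' Γ'
insertᶜ-cong zero    p q = ∷ᶜ-cong p q
insertᶜ-cong (suc k) p q = ∷ᶜ-cong (q zero) (insertᶜ-cong k p (λ i → q (suc i)))

insertᶜ-⊎ᶜ : ∀ k M N Γ Δ → insertᶜ k (M ++ N) (Γ ⊎ᶜ Δ) ≗ (insertᶜ k M Γ ⊎ᶜ insertᶜ k N Δ)
insertᶜ-⊎ᶜ zero    M N Γ Δ zero    = refl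
insertᶜ-⊎ᶜ zero    M N Γ Δ (suc i) = refl
insertᶜ-⊎ᶜ (suc k) M N Γ Δ zero    = refl
insertᶜ-⊎ᶜ (suc k) M N Γ Δ (suc i) = insertᶜ-⊎ᶜ k M N (tailᶜ Γ) (tailᶜ Δ) i

insertᶜ-∅ᶜ : ∀ k → insertᶜ k [] ∅ᶜ ≗ ∅ᶜ
insertᶜ-∅ᶜ zero    zero    = refl
insertᶜ-∅ᶜ zero    (suc i) = refl
insertᶜ-∅ᶜ (suc k) zero    = refl
insertᶜ-∅ᶜ (suc k) (suc i) = insertᶜ-∅ᶜ k i

insertᶜ-∅ᶜ⁺ : ∀ k {M Γ} → M ≈ᴹ [] → Γ ≈ᶜ ∅ᶜ → insertᶜ k M Γ ≈ᶜ ∅ᶜ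
insertᶜ-∅ᶜ⁺ k p q = ≈ᶜ-trans (insertᶜ-cong k p q) (≗⇒≈ᶜ (insertᶜ-∅ᶜ k))

insertᶜ-∅ᶜ⁻ : ∀ k {M Γ} → insertᶜ k M Γ ≈ᶜ ∅ᶜ → M ≈ᴹ [] × Γ ≈ᶜ ∅ᶜ
insertᶜ-∅ᶜ⁻ zero    p = p zero , (λ i → p (suc i))
insertᶜ-∅ᶜ⁻ (suc k) p with insertᶜ-∅ᶜ⁻ k (λ i → p (suc i))
... | M≈[] , tail≈∅ = M≈[] , λ { zero → p zero ; (suc i) → tail≈∅ i }

insertᶜ-removeᶜ : ∀ k Γ → Γ ≗ insertᶜ k (Γ k) (removeᶜ k Γ)
insertᶜ-removeᶜ zero    Γ zero    = refl
insertᶜ-removeᶜ zero    Γ (suc i) = refl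
insertᶜ-removeᶜ (suc k) Γ zero    = refl
insertᶜ-removeᶜ (suc k) Γ (suc i) = insertᶜ-removeᶜ k (tailᶜ Γ) i

removeᶜ-insertᶜ : ∀ k M Γ → removeᶜ k (insertᶜ k M Γ) ≗ Γ
removeᶜ-insertᶜ zero    M Γ i       = refl
removeᶜ-insertᶜ (suc k) M Γ zero    = refl
removeᶜ-insertᶜ (suc k) M Γ (suc i) = removeᶜ-insertᶜ k M (tailᶜ Γ) i

removeᶜ-cong : ∀ k {Γ Γ'} → Γ ≈ᶜ Γ' → removeᶜ k Γ ≈ᶜ removeᶜ k Γ'
removeᶜ-cong zero    p i = p (suc i)
removeᶜ-cong (suc k) p   = ∷ᶜ-cong (p zero) (removeᶜ-cong k (λ i → p (suc i)))

removeᶜ-⊎ᶜ : ∀ k Γ Δ → removeᶜ k (Γ ⊎ᶜ Δ) ≗ (removeᶜ k Γ ⊎ᶜ removeᶜ k Δ)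
removeᶜ-⊎ᶜ zero    Γ Δ i       = refl
removeᶜ-⊎ᶜ (suc k) Γ Δ zero    = refl
removeᶜ-⊎ᶜ (suc k) Γ Δ (suc i) = removeᶜ-⊎ᶜ k (tailᶜ Γ) (tailᶜ Δ) i

removeᶜ-∅ᶜ : ∀ k → removeᶜ k ∅ᶜ ≗ ∅ᶜ
removeᶜ-∅ᶜ zero    i       = refl
removeᶜ-∅ᶜ (suc k) zero    = refl
removeᶜ-∅ᶜ (suc k) (suc i) = removeᶜ-∅ᶜ k i

shiftᶜ-cong : ∀ k {Δ Δ'} → Δ ≈ᶜ Δ' → shiftᶜ k Δ ≈ᶜ shiftᶜ k Δ'
shiftᶜ-cong zero    p = p
shiftᶜ-cong (suc k) p = ∷ᶜ-cong [] (shiftᶜ-cong k p)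

shiftᶜ-⊎ᶜ : ∀ k Δ Δ' → shiftᶜ k (Δ ⊎ᶜ Δ') ≗ (shiftᶜ k Δ ⊎ᶜ shiftᶜ k Δ')
shiftᶜ-⊎ᶜ zero    Δ Δ' i       = refl
shiftᶜ-⊎ᶜ (suc k) Δ Δ' zero    = refl
shiftᶜ-⊎ᶜ (suc k) Δ Δ' (suc i) = shiftᶜ-⊎ᶜ k Δ Δ' i

shiftᶜ-∅ᶜ⁺ : ∀ k {Δ} → Δ ≈ᶜ ∅ᶜ → shiftᶜ k Δ ≈ᶜ ∅ᶜ
shiftᶜ-∅ᶜ⁺ zero    p = p
shiftᶜ-∅ᶜ⁺ (suc k) p = λ { zero → [] ; (suc i) → shiftᶜ-∅ᶜ⁺ k p i }

insertᶜ-singleᶜ : ∀ k x N → insertᶜ k [] (singleᶜ x N) ≗ singleᶜ (punchIn k x) N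
insertᶜ-singleᶜ zero    x       N zero    = refl
insertᶜ-singleᶜ zero    x       N (suc i) = refl
insertᶜ-singleᶜ (suc k) zero    N zero    = refl
insertᶜ-singleᶜ (suc k) zero    N (suc i) = insertᶜ-∅ᶜ k i
insertᶜ-singleᶜ (suc k) (suc x) N zero    = refl
insertᶜ-singleᶜ (suc k) (suc x) N (suc i) = insertᶜ-singleᶜ k x N i

removeᶜ-singleᶜ : ∀ k x N → singleᶜ (punchIn k x) N k ≡ [] × removeᶜ k (singleᶜ (punchIn k x) N) ≗ singleᶜ x N
removeᶜ-singleᶜ zero    x       N = refl , (λ i → refl)
removeᶜ-singleᶜ (suc k) zero    N = refl , λ { zero → refl ; (suc i) → removeᶜ-∅ᶜ k i }
removeᶜ-singleᶜ (suc k) (suc x) N with removeᶜ-singleᶜ k x N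
... | slot-empty , removed = slot-empty , λ { zero → refl ; (suc i) → removed i }

-- Sized typing of Plotkin terms

-- The many rule of _⊢_∶_ is unfolded into nil and cons.
data _⊩ₗ_∶_#_ : Ctx → PTm → Lin → ℕ → Set
data _⊩_∶_#_  : Ctx → PTm → Multi → ℕ → Set

data _⊩ₗ_∶_#_ where
  ax  : ∀ {Γ x L} → Γ ≈ᶜ singleᶜ x [ L ] → Γ ⊩ₗ var x ∶ L # 0
  abs : ∀ {Γ t M N n} → (M ∷ᶜ Γ) ⊩ t ∶ N # n → Γ ⊩ₗ lam t ∶ (M ⊸ N) # suc n

data _⊩_∶_#_ where
  nil  : ∀ {Θ v} → IsVal v → Θ ≈ᶜ ∅ᶜ → Θ ⊩ v ∶ [] # 0
  cons : ∀ {Γ Δ Θ v L M a b} → Γ ⊩ₗ v ∶ L # a → Δ ⊩ v ∶ M # b →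
         Θ ≈ᶜ (Γ ⊎ᶜ Δ) → Θ ⊩ v ∶ (L ∷ M) # (a + b)
  app  : ∀ {Γ Δ Θ t u M N a b} → Γ ⊩ t ∶ [ M ⊸ N ] # a → Δ ⊩ u ∶ M # b →
         Θ ≈ᶜ (Γ ⊎ᶜ Δ) → Θ ⊩ app t u ∶ N # suc (a + b)

_⊩_∶_ : Ctx → PTm → Multi → Set
Γ ⊩ t ∶ M = ∃ λ n → Γ ⊩ t ∶ M # n

⊩-cast : ∀ {Θ t M n n'} → n ≡ n' → Θ ⊩ t ∶ M # n → Θ ⊩ t ∶ M # n'
⊩-cast refl d = d

⊩-≈ᶜ : ∀ {Θ Θ' t M n} → Θ ≈ᶜ Θ' → Θ ⊩ t ∶ M # n → Θ' ⊩ t ∶ M # n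
⊩-≈ᶜ p (nil v c)    = nil v (≈ᶜ-trans (≈ᶜ-sym p) c)
⊩-≈ᶜ p (cons d e c) = cons d e (≈ᶜ-trans (≈ᶜ-sym p) c)
⊩-≈ᶜ p (app d e c)  = app d e (≈ᶜ-trans (≈ᶜ-sym p) c)

⊩-≈ᴹ  : ∀ {Θ t M M' n} → Θ ⊩ t ∶ M # n → M ≈ᴹ M' → Θ ⊩ t ∶ M' # n
⊩ₗ-≈ᴸ : ∀ {Θ t L L' n} → Θ ⊩ₗ t ∶ L # n → L ≈ᴸ L' → Θ ⊩ₗ t ∶ L' # n
⊩-≈ᴹ (app d e c)  p       = app (⊩-≈ᴹ d (⊸-cong ≈ᴹ-refl p ∷ [])) e c
⊩-≈ᴹ (nil v c)    []      = nil v c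
⊩-≈ᴹ (cons d e c) (p ∷ q) = cons (⊩ₗ-≈ᴸ d p) (⊩-≈ᴹ e q) c
⊩-≈ᴹ (cons {Γ = Γ₁} {a = a₁} d₁ (cons {Γ = Γ₂} {Δ = Γ₃} {a = a₂} {b = a₃} d₂ d₃ c₂) c₁) swap =
  ⊩-cast (ℕ+.x∙yz≈y∙xz a₂ a₁ a₃)
    (cons d₂ (cons d₁ d₃ ≈ᶜ-refl)
      (≈ᶜ-trans c₁ (≈ᶜ-trans (⊎ᶜ-cong ≈ᶜ-refl c₂) (Ctx⊎.x∙yz≈y∙xz Γ₁ Γ₂ Γ₃))))
⊩-≈ᴹ d@(nil _ _)  (trans p q) = ⊩-≈ᴹ (⊩-≈ᴹ d p) q
⊩-≈ᴹ d@(cons _ _ _) (trans p q) = ⊩-≈ᴹ (⊩-≈ᴹ d p) q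
⊩ₗ-≈ᴸ (ax {x = x} c) p            = ax (≈ᶜ-trans c (singleᶜ-cong x (p ∷ [])))
⊩ₗ-≈ᴸ (abs d)        (⊸-cong p q) = abs (⊩-≈ᴹ (⊩-≈ᶜ (∷ᶜ-cong p ≈ᶜ-refl) d) q)

⊩ₗ-isVal : ∀ {Γ v L n} → Γ ⊩ₗ v ∶ L # n → IsVal v
⊩ₗ-isVal (ax {x = x} _)  = var x
⊩ₗ-isVal (abs {t = t} _) = lam t

⊩-var⁺ : ∀ {Θ x} N → Θ ≈ᶜ singleᶜ x N → Θ ⊩ var x ∶ N # 0
⊩-var⁺ {x = x} []      c = nil (var x) (≈ᶜ-trans c (≗⇒≈ᶜ (singleᶜ-[] x)))
⊩-var⁺ {x = x} (L ∷ N) c =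
  cons (ax ≈ᶜ-refl) (⊩-var⁺ N ≈ᶜ-refl) (≈ᶜ-trans c (≈ᶜ-sym (≗⇒≈ᶜ (singleᶜ-++ x [ L ] N))))

⊩-var⁻ : ∀ {Θ x N n} → Θ ⊩ var x ∶ N # n → Θ ≈ᶜ singleᶜ x N × n ≡ 0
⊩-var⁻ {x = x} (nil _ c) = ≈ᶜ-trans c (≈ᶜ-sym (≗⇒≈ᶜ (singleᶜ-[] x))) , refl
⊩-var⁻ {x = x} (cons {L = L} {M = M} (ax c₁) e c) with ⊩-var⁻ e
... | c₂ , refl = ≈ᶜ-trans c (≈ᶜ-trans (⊎ᶜ-cong c₁ c₂) (≗⇒≈ᶜ (singleᶜ-++ x [ L ] M))) , refl

⊩-[]⁻ : ∀ {Θ v n} → IsVal v → Θ ⊩ v ∶ [] # n → Θ ≈ᶜ ∅ᶜ × n ≡ 0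
⊩-[]⁻ _  (nil _ c)     = c , refl
⊩-[]⁻ () (app _ _ _)

⊩-++⁺ : ∀ {Γ Δ v M N a b} → IsVal v → Γ ⊩ v ∶ M # a → Δ ⊩ v ∶ N # b →
        (Γ ⊎ᶜ Δ) ⊩ v ∶ (M ++ N) # (a + b)
⊩-++⁺ () (app _ _ _) e
⊩-++⁺ {Δ = Δ} val (nil _ c) e = ⊩-≈ᶜ (λ i → ≈ᴹ-sym (++-congˡ (Δ i) (c i))) e
⊩-++⁺ {Δ = Δ} val (cons {Γ = Γ₁} {Δ = Γ₂} {a = a} {b = b} d d' c) e =
  ⊩-cast (≡-sym (+-assoc a b _))
    (cons d (⊩-++⁺ val d' e) (≈ᶜ-trans (⊎ᶜ-cong c ≈ᶜ-refl) (⊎ᶜ-assoc Γ₁ Γ₂ Δ)))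

⊩-++⁻ : ∀ M {N Θ v n} → IsVal v → Θ ⊩ v ∶ (M ++ N) # n →
        ∃ λ Γ → ∃ λ Δ → ∃ λ a → ∃ λ b →
        Θ ≈ᶜ (Γ ⊎ᶜ Δ) × Γ ⊩ v ∶ M # a × Δ ⊩ v ∶ N # b × n ≡ a + b
⊩-++⁻ []      {Θ = Θ} val d = ∅ᶜ , Θ , 0 , _ , ≈ᶜ-refl , nil val ≈ᶜ-refl , d , refl
⊩-++⁻ (L ∷ M) ()  (app _ _ _)
⊩-++⁻ (L ∷ M) val (cons {Γ = Γ₀} {a = a₀} dₗ d c) with ⊩-++⁻ M val d
... | Γ , Δ , a , b , c' , dM , dN , refl =
  (Γ₀ ⊎ᶜ Γ) , Δ , a₀ + a , b ,
  ≈ᶜ-trans c (≈ᶜ-trans (⊎ᶜ-cong ≈ᶜ-refl c') (≈ᶜ-sym (⊎ᶜ-assoc Γ₀ Γ Δ))) ,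
  cons dₗ dM ≈ᶜ-refl , dN , ≡-sym (+-assoc a₀ a b)

not-occurs⇒≈[]  : ∀ {z t Θ M n} → ¬ Occurs z t → Θ ⊩ t ∶ M # n → Θ z ≈ᴹ []
not-occurs⇒≈[]ₗ : ∀ {z t Θ L n} → ¬ Occurs z t → Θ ⊩ₗ t ∶ L # n → Θ z ≈ᴹ []
not-occurs⇒≈[] z∉ (nil _ c)    = c _
not-occurs⇒≈[] z∉ (cons d e c) = trans (c _) (++-≈ᴹ[] (not-occurs⇒≈[]ₗ z∉ d) (not-occurs⇒≈[] z∉ e))
not-occurs⇒≈[] z∉ (app d e c)  =
  trans (c _) (++-≈ᴹ[] (not-occurs⇒≈[] (λ o → z∉ (appl o)) d) (not-occurs⇒≈[] (λ o → z∉ (appr o)) e))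
not-occurs⇒≈[]ₗ {z} z∉ (ax {x = x} {L = L} c) = trans (c z) (≈ᴹ-reflexive (singleᶜ-≢ x [ L ] λ { refl → z∉ (var x) }))
not-occurs⇒≈[]ₗ z∉ (abs d) = not-occurs⇒≈[] (λ o → z∉ (lam o)) d

rename-isVal : ∀ ρ {v} → IsVal v → IsVal (rename ρ v)
rename-isVal ρ (var x) = var (ρ x)
rename-isVal ρ (lam t) = lam (rename (ext ρ) t)

insertᶜ-[]-split : ∀ k {Θ Γ Δ} → Θ ≈ᶜ (Γ ⊎ᶜ Δ) → insertᶜ k [] Θ ≈ᶜ (insertᶜ k [] Γ ⊎ᶜ insertᶜ k [] Δ)
insertᶜ-[]-split k {Γ = Γ} {Δ} c = ≈ᶜ-trans (insertᶜ-cong k [] c) (≗⇒≈ᶜ (insertᶜ-⊎ᶜ k [] [] Γ Δ))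

removeᶜ-split : ∀ k {Θ Γ Δ} → Θ ≈ᶜ (Γ ⊎ᶜ Δ) → removeᶜ k Θ ≈ᶜ (removeᶜ k Γ ⊎ᶜ removeᶜ k Δ)
removeᶜ-split k {Γ = Γ} {Δ} c = ≈ᶜ-trans (removeᶜ-cong k c) (≗⇒≈ᶜ (removeᶜ-⊎ᶜ k Γ Δ))

⊩-weaken  : ∀ k {Γ t M n} → Γ ⊩ t ∶ M # n → insertᶜ k [] Γ ⊩ rename (punchIn k) t ∶ M # n
⊩ₗ-weaken : ∀ k {Γ t L n} → Γ ⊩ₗ t ∶ L # n → insertᶜ k [] Γ ⊩ₗ rename (punchIn k) t ∶ L # n
⊩-weaken k (nil val c)  = nil (rename-isVal (punchIn k) val) (insertᶜ-∅ᶜ⁺ k [] c)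
⊩-weaken k (cons d e c) = cons (⊩ₗ-weaken k d) (⊩-weaken k e) (insertᶜ-[]-split k c)
⊩-weaken k (app d e c)  = app (⊩-weaken k d) (⊩-weaken k e) (insertᶜ-[]-split k c)
⊩ₗ-weaken k (ax {x = x} {L = L} c) = ax (≈ᶜ-trans (insertᶜ-cong k [] c) (≗⇒≈ᶜ (insertᶜ-singleᶜ k x [ L ])))
⊩ₗ-weaken k (abs d)                = abs (⊩-weaken (suc k) d)

⊩-strengthen     : ∀ k t {Θ M n} → Θ ⊩ rename (punchIn k) t ∶ M # n →
                   Θ k ≈ᴹ [] × removeᶜ k Θ ⊩ t ∶ M # n
⊩-strengthen-lam : ∀ k t {Θ M n} → Θ ⊩ lam (rename (ext (punchIn k)) t) ∶ M # n →
                   Θ k ≈ᴹ [] × removeᶜ k Θ ⊩ lam t ∶ M # n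
⊩-strengthen k (var x) {M = M} d with ⊩-var⁻ d
... | c , refl = trans (c k) (≈ᴹ-reflexive (proj₁ (removeᶜ-singleᶜ k x M))) ,
                 ⊩-var⁺ M (≈ᶜ-trans (removeᶜ-cong k c) (≗⇒≈ᶜ (proj₂ (removeᶜ-singleᶜ k x M))))
⊩-strengthen k (lam t) d = ⊩-strengthen-lam k t d
⊩-strengthen k (app t u) (app d e c) with ⊩-strengthen k t d | ⊩-strengthen k u e
... | tk≈[] , d' | uk≈[] , e' = trans (c k) (++-≈ᴹ[] tk≈[] uk≈[]) , app d' e' (removeᶜ-split k c)
⊩-strengthen-lam k t (nil _ c) = c k , nil (lam t) (≈ᶜ-trans (removeᶜ-cong k c) (≗⇒≈ᶜ (removeᶜ-∅ᶜ k)))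
⊩-strengthen-lam k t (cons (abs d) e c) with ⊩-strengthen (suc k) t d | ⊩-strengthen-lam k t e
... | dk≈[] , d' | ek≈[] , e' = trans (c k) (++-≈ᴹ[] dk≈[] ek≈[]) , cons (abs d') e' (removeᶜ-split k c)

-- Substitution and anti-substitution of values

-- substAt k v replaces index k by v (renamed past k binders) and decrements
-- the indices above k; Γ ⊎ᶜ shiftᶜ k Δ is the matching context.
substAt : ℕ → PTm → ℕ → PTm
substAt zero    v = sub0 v
substAt (suc k) v = exts (substAt k v)

⊩-value-split : ∀ k {Θ M Γ Γ₁ Γ₂ Δ v b} → IsVal v → Θ ≈ᶜ insertᶜ k M Γ → Θ ≈ᶜ (Γ₁ ⊎ᶜ Γ₂) →
                Δ ⊩ v ∶ M # b →
                ∃ λ Δ₁ → ∃ λ Δ₂ → ∃ λ b₁ → ∃ λ b₂ →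
                  (Γ ⊎ᶜ shiftᶜ k Δ) ≈ᶜ ((removeᶜ k Γ₁ ⊎ᶜ shiftᶜ k Δ₁) ⊎ᶜ (removeᶜ k Γ₂ ⊎ᶜ shiftᶜ k Δ₂)) ×
                  Δ₁ ⊩ v ∶ Γ₁ k # b₁ × Δ₂ ⊩ v ∶ Γ₂ k # b₂ × b ≡ b₁ + b₂
⊩-value-split k {Θ} {M} {Γ} {Γ₁} {Γ₂} val Θ≈ins Θ≈split dv
  with ⊩-++⁻ (Γ₁ k) val (⊩-≈ᴹ dv M-split)
  where
  M-split : M ≈ᴹ (Γ₁ k ++ Γ₂ k)
  M-split = trans (≈ᴹ-reflexive (≡-sym (insertᶜ-self k M Γ))) (trans (≈ᴹ-sym (Θ≈ins k)) (Θ≈split k))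
... | Δ₁ , Δ₂ , b₁ , b₂ , Δ-split , d₁ , d₂ , b≡ =
  Δ₁ , Δ₂ , b₁ , b₂ ,
  ≈ᶜ-trans (⊎ᶜ-cong Γ-split (≈ᶜ-trans (shiftᶜ-cong k Δ-split) (≗⇒≈ᶜ (shiftᶜ-⊎ᶜ k Δ₁ Δ₂))))
           (Ctx⊎.interchange (removeᶜ k Γ₁) (removeᶜ k Γ₂) (shiftᶜ k Δ₁) (shiftᶜ k Δ₂)) ,
  d₁ , d₂ , b≡
  where
  Γ-split : Γ ≈ᶜ (removeᶜ k Γ₁ ⊎ᶜ removeᶜ k Γ₂)
  Γ-split = ≈ᶜ-trans (≈ᶜ-sym (≗⇒≈ᶜ (removeᶜ-insertᶜ k M Γ)))
              (≈ᶜ-trans (removeᶜ-cong k (≈ᶜ-sym Θ≈ins)) (removeᶜ-split k Θ≈split))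

⊩-subst-var : ∀ k x {M Γ N Δ v b} → IsVal v → insertᶜ k M Γ ≈ᶜ singleᶜ x N → Δ ⊩ v ∶ M # b →
              (Γ ⊎ᶜ shiftᶜ k Δ) ⊩ substAt k v x ∶ N # b
⊩-subst-var zero zero {Δ = Δ} val p dv =
  ⊩-≈ᶜ (λ i → ≈ᴹ-sym (++-congˡ (Δ i) (p (suc i)))) (⊩-≈ᴹ dv (p zero))
⊩-subst-var zero (suc y) {Γ = Γ} val p dv with ≈ᴹ[]⇒≡[] (p zero)
... | refl with ⊩-[]⁻ val dv
... | Δ≈∅ , refl = ⊩-var⁺ _ (≈ᶜ-trans (⊎ᶜ-cong ≈ᶜ-refl Δ≈∅) (≈ᶜ-trans (⊎ᶜ-identityʳ Γ) (λ i → p (suc i))))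
⊩-subst-var (suc k) zero {M = M} {Γ} val p dv with insertᶜ-∅ᶜ⁻ k {M} {tailᶜ Γ} (λ i → p (suc i))
... | M≈[] , tail≈∅ with ≈ᴹ[]⇒≡[] M≈[]
... | refl with ⊩-[]⁻ val dv
... | Δ≈∅ , refl = ⊩-var⁺ _ λ { zero    → trans (≈ᴹ-reflexive (++-identityʳ (Γ zero))) (p zero)
                             ; (suc i) → ++-≈ᴹ[] (tail≈∅ i) (shiftᶜ-∅ᶜ⁺ k Δ≈∅ i) }
⊩-subst-var (suc k) (suc y) {Γ = Γ} val p dv =
  ⊩-≈ᶜ (λ { zero → ≈ᴹ-sym (trans (≈ᴹ-reflexive (++-identityʳ (Γ zero))) (p zero)) ; (suc i) → ≈ᴹ-refl })
    (⊩-weaken zero (⊩-subst-var k y val (λ i → p (suc i)) dv))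

⊩-subst     : ∀ k t {Θ M Γ N a Δ v b} → IsVal v → Θ ≈ᶜ insertᶜ k M Γ →
              Θ ⊩ t ∶ N # a → Δ ⊩ v ∶ M # b →
              (Γ ⊎ᶜ shiftᶜ k Δ) ⊩ subst (substAt k v) t ∶ N # (a + b)
⊩-subst-lam : ∀ k t {Θ M Γ N a Δ v b} → IsVal v → Θ ≈ᶜ insertᶜ k M Γ →
              Θ ⊩ lam t ∶ N # a → Δ ⊩ v ∶ M # b →
              (Γ ⊎ᶜ shiftᶜ k Δ) ⊩ lam (subst (exts (substAt k v)) t) ∶ N # (a + b)
⊩-subst k (var x) val Θ≈ d dv with ⊩-var⁻ d
... | Θ≈x , refl = ⊩-subst-var k x val (≈ᶜ-trans (≈ᶜ-sym Θ≈) Θ≈x) dv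
⊩-subst k (lam t) val Θ≈ d dv = ⊩-subst-lam k t val Θ≈ d dv
⊩-subst k (app t u) val Θ≈ (app {Γ = Γ₁} {Δ = Γ₂} {a = a₁} {b = a₂} d₁ d₂ c) dv
  with ⊩-value-split k {Γ₁ = Γ₁} {Γ₂ = Γ₂} val Θ≈ c dv
... | Δ₁ , Δ₂ , b₁ , b₂ , split , e₁ , e₂ , refl =
  ⊩-cast (cong suc (ℕ+.interchange a₁ b₁ a₂ b₂))
    (app (⊩-subst k t val (≗⇒≈ᶜ (insertᶜ-removeᶜ k Γ₁)) d₁ e₁)
         (⊩-subst k u val (≗⇒≈ᶜ (insertᶜ-removeᶜ k Γ₂)) d₂ e₂) split)
⊩-subst-lam k t {Γ = Γ} val Θ≈ (nil _ c) dv with insertᶜ-∅ᶜ⁻ k (≈ᶜ-trans (≈ᶜ-sym Θ≈) c)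
... | M≈[] , Γ≈∅ with ≈ᴹ[]⇒≡[] M≈[]
... | refl with ⊩-[]⁻ val dv
... | Δ≈∅ , refl = nil (lam _) (λ i → ++-≈ᴹ[] (Γ≈∅ i) (shiftᶜ-∅ᶜ⁺ k Δ≈∅ i))
⊩-subst-lam k t val Θ≈ (cons {Γ = Γ₁} {Δ = Γ₂} (abs {M = C} {n = a₁} d) e c) dv
  with ⊩-value-split k {Γ₁ = Γ₁} {Γ₂ = Γ₂} val Θ≈ c dv
... | Δ₁ , Δ₂ , b₁ , b₂ , split , e₁ , e₂ , refl =
  ⊩-cast (cong suc (ℕ+.interchange a₁ b₁ _ b₂))
   (cons (abs (⊩-≈ᶜ (λ { zero → ≈ᴹ-reflexive (++-identityʳ C) ; (suc i) → ≈ᴹ-refl })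
                   (⊩-subst (suc k) t {Γ = C ∷ᶜ removeᶜ k Γ₁} val (∷ᶜ-cong ≈ᴹ-refl (≗⇒≈ᶜ (insertᶜ-removeᶜ k Γ₁))) d e₁)))
         (⊩-subst-lam k t val (≗⇒≈ᶜ (insertᶜ-removeᶜ k Γ₂)) e e₂)
         split)

record Unsubst (k : ℕ) (t : PTm) (Θ : Ctx) (N : Multi) (v : PTm) : Set where
  constructor unsubst
  field
    M     : Multi
    Γ Δ   : Ctx
    a b   : ℕ
    split : Θ ≈ᶜ (Γ ⊎ᶜ shiftᶜ k Δ)
    ⊩t    : insertᶜ k M Γ ⊩ t ∶ N # a
    ⊩v    : Δ ⊩ v ∶ M # b

shiftᶜ-split-merge : ∀ k {Θ Θ₁ Θ₂ Γ₁ Γ₂ Δ₁ Δ₂} → Θ ≈ᶜ (Θ₁ ⊎ᶜ Θ₂) →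
                     Θ₁ ≈ᶜ (Γ₁ ⊎ᶜ shiftᶜ k Δ₁) → Θ₂ ≈ᶜ (Γ₂ ⊎ᶜ shiftᶜ k Δ₂) →
                     Θ ≈ᶜ ((Γ₁ ⊎ᶜ Γ₂) ⊎ᶜ shiftᶜ k (Δ₁ ⊎ᶜ Δ₂))
shiftᶜ-split-merge k {Γ₁ = Γ₁} {Γ₂} {Δ₁} {Δ₂} c c₁ c₂ =
  ≈ᶜ-trans c (≈ᶜ-trans (⊎ᶜ-cong c₁ c₂) (≈ᶜ-trans (Ctx⊎.interchange Γ₁ (shiftᶜ k Δ₁) Γ₂ (shiftᶜ k Δ₂))
    (⊎ᶜ-cong ≈ᶜ-refl (≈ᶜ-sym (≗⇒≈ᶜ (shiftᶜ-⊎ᶜ k Δ₁ Δ₂))))))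

unsubst-nothing : ∀ k {t Θ N v} → IsVal v → insertᶜ k [] Θ ⊩ t ∶ N # 0 → Unsubst k t Θ N v
unsubst-nothing k {Θ = Θ} val d =
  unsubst [] Θ ∅ᶜ 0 0 (≈ᶜ-sym (≈ᶜ-trans (⊎ᶜ-cong ≈ᶜ-refl (shiftᶜ-∅ᶜ⁺ k ≈ᶜ-refl)) (⊎ᶜ-identityʳ Θ))) d (nil val ≈ᶜ-refl)

⊩-unsubst-var : ∀ k x {Θ N n v} → IsVal v → Θ ⊩ substAt k v x ∶ N # n → Unsubst k (var x) Θ N v
⊩-unsubst-var zero zero {Θ} {N} val d = unsubst N ∅ᶜ Θ 0 _ ≈ᶜ-refl (⊩-var⁺ N ≈ᶜ-refl) d
⊩-unsubst-var zero (suc y) {N = N} val d with ⊩-var⁻ d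
... | c , refl = unsubst-nothing zero val (⊩-var⁺ N (∷ᶜ-cong [] c))
⊩-unsubst-var (suc k) zero {N = N} val d with ⊩-var⁻ d
... | c , refl = unsubst-nothing (suc k) val (⊩-var⁺ N (∷ᶜ-cong (c zero) (insertᶜ-∅ᶜ⁺ k [] (λ i → c (suc i)))))
⊩-unsubst-var (suc k) (suc y) {N = N} {v = v} val d with ⊩-strengthen zero (substAt k v y) d
... | 0≈[] , d' with ⊩-unsubst-var k y val d'
... | unsubst M Γ Δ a b c dy dv with ⊩-var⁻ dy
... | c' , refl = unsubst M ([] ∷ᶜ Γ) Δ 0 b (λ { zero → 0≈[] ; (suc i) → c i }) (⊩-var⁺ N (∷ᶜ-cong [] c')) dv

⊩-unsubst     : ∀ k t {Θ N n v} → IsVal v → Θ ⊩ subst (substAt k v) t ∶ N # n → Unsubst k t Θ N v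
⊩-unsubst-lam : ∀ k t {Θ N n v} → IsVal v → Θ ⊩ lam (subst (exts (substAt k v)) t) ∶ N # n →
                Unsubst k (lam t) Θ N v
⊩-unsubst k (var x) val d = ⊩-unsubst-var k x val d
⊩-unsubst k (lam t) val d = ⊩-unsubst-lam k t val d
⊩-unsubst k (app t u) val (app d e c) with ⊩-unsubst k t val d | ⊩-unsubst k u val e
... | unsubst M₁ Γ₁ Δ₁ _ _ c₁ dt dv₁ | unsubst M₂ Γ₂ Δ₂ _ _ c₂ du dv₂ =
  unsubst (M₁ ++ M₂) (Γ₁ ⊎ᶜ Γ₂) (Δ₁ ⊎ᶜ Δ₂) _ _ (shiftᶜ-split-merge k c c₁ c₂)
    (app dt du (≗⇒≈ᶜ (insertᶜ-⊎ᶜ k M₁ M₂ Γ₁ Γ₂))) (⊩-++⁺ val dv₁ dv₂)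
⊩-unsubst-lam k t val (nil _ c) = unsubst-nothing k val (nil (lam t) (insertᶜ-∅ᶜ⁺ k [] c))
⊩-unsubst-lam k t val (cons (abs d) e c) with ⊩-unsubst (suc k) t val d | ⊩-unsubst-lam k t val e
... | unsubst M₁ Γ₁ Δ₁ _ _ c₁ dt dv₁ | unsubst M₂ Γ₂ Δ₂ _ _ c₂ dl dv₂ =
  unsubst (M₁ ++ M₂) (tailᶜ Γ₁ ⊎ᶜ Γ₂) (Δ₁ ⊎ᶜ Δ₂) _ _ (shiftᶜ-split-merge k c (λ i → c₁ (suc i)) c₂)
    (cons (abs (⊩-≈ᶜ (λ { zero → ≈ᴹ-sym (trans (c₁ zero) (≈ᴹ-reflexive (++-identityʳ (Γ₁ zero))))
                       ; (suc i) → ≈ᴹ-refl }) dt))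
          dl (≗⇒≈ᶜ (insertᶜ-⊎ᶜ k M₁ M₂ (tailᶜ Γ₁) Γ₂)))
    (⊩-++⁺ val dv₁ dv₂)

-- Left reduction

data _⟶_ : PTm → PTm → Set where
  β    : ∀ {t v} → IsVal v → app (lam t) v ⟶ (t ⟦ v ⟧)
  appˡ : ∀ {t t' u} → t ⟶ t' → app t u ⟶ app t' u
  appʳ : ∀ {v u u'} → IsVal v → u ⟶ u' → app v u ⟶ app v u'

plug-⟶ : ∀ L {t v} → IsVal v → plug L (app (lam t) v) ⟶ plug L (t ⟦ v ⟧)
plug-⟶ hole       val = β val
plug-⟶ (vL v p L) val = appʳ p (plug-⟶ L val)
plug-⟶ (Lt L u)   val = appˡ (plug-⟶ L val)

→l⇒⟶ : ∀ {t t'} → t →l t' → t ⟶ t'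
→l⇒⟶ (left L val) = plug-⟶ L val

⟶⇒→l : ∀ {t t'} → t ⟶ t' → t →l t'
⟶⇒→l (β val) = left hole val
⟶⇒→l (appˡ {u = u} r) with ⟶⇒→l r
... | left L val = left (Lt L u) val
⟶⇒→l (appʳ {v = v} p r) with ⟶⇒→l r
... | left L val = left (vL v p L) val

progress : ∀ t → (∃ λ t' → t ⟶ t') ⊎ (∀ t' → ¬ (t ⟶ t'))
progress (var x) = inj₂ λ _ ()
progress (lam t) = inj₂ λ _ ()
progress (app t u) with progress t
... | inj₁ (t' , r) = inj₁ (_ , appˡ r)
progress (app (app t₁ t₂) u) | inj₂ t-nf = inj₂ λ { _ (appˡ r) → t-nf _ r ; _ (appʳ () _) }
progress (app (var x) u)     | inj₂ t-nf with progress u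
... | inj₁ (u' , r) = inj₁ (_ , appʳ (var x) r)
... | inj₂ u-nf     = inj₂ λ { _ (appˡ r) → t-nf _ r ; _ (appʳ _ r) → u-nf _ r }
progress (app (lam t) u)     | inj₂ t-nf with progress u
... | inj₁ (u' , r) = inj₁ (_ , appʳ (lam t) r)
progress (app (lam t) (var y))     | inj₂ _ | inj₂ _ = inj₁ (_ , β (var y))
progress (app (lam t) (lam u))     | inj₂ _ | inj₂ _ = inj₁ (_ , β (lam u))
progress (app (lam t) (app u₁ u₂)) | inj₂ t-nf | inj₂ u-nf =
  inj₂ λ { _ (β ()) ; _ (appˡ r) → t-nf _ r ; _ (appʳ _ r) → u-nf _ r }

β-size : ∀ s b → s + b < suc (suc s + 0 + b)
β-size s b rewrite +-identityʳ s = s≤s (n≤1+n (s + b))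

subject-reduction : ∀ {Θ t t' N n} → Θ ⊩ t ∶ N # n → t ⟶ t' → ∃ λ n' → n' < n × Θ ⊩ t' ∶ N # n'
subject-reduction (app (cons {Γ = Γ} (abs {n = s} d) (nil _ e) c₁) dv c) (β {t} val) =
  _ , β-size s _ ,
  ⊩-≈ᶜ (≈ᶜ-sym (≈ᶜ-trans c (⊎ᶜ-cong (≈ᶜ-trans c₁ (≈ᶜ-trans (⊎ᶜ-cong ≈ᶜ-refl e) (⊎ᶜ-identityʳ Γ))) ≈ᶜ-refl)))
    (⊩-subst zero t {Γ = Γ} val ≈ᶜ-refl d dv)
subject-reduction (app {b = b} d e c) (appˡ r) with subject-reduction d r
... | _ , n'<n , d' = _ , s≤s (+-monoˡ-< b n'<n) , app d' e c
subject-reduction (app {a = a} d e c) (appʳ _ r) with subject-reduction e r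
... | _ , n'<n , e' = _ , s≤s (+-monoʳ-< a n'<n) , app d e' c

subject-expansion : ∀ {Θ t t' N n} → Θ ⊩ t' ∶ N # n → t ⟶ t' → Θ ⊩ t ∶ N
subject-expansion d (β {t} val) with ⊩-unsubst zero t val d
... | unsubst M Γ Δ _ _ c dt dv = _ , app (cons (abs dt) (nil (lam t) ≈ᶜ-refl) (≈ᶜ-sym (⊎ᶜ-identityʳ Γ))) dv c
subject-expansion (app d e c) (appˡ r) = _ , app (proj₂ (subject-expansion d r)) e c
subject-expansion (app d e c) (appʳ _ r) = _ , app d (proj₂ (subject-expansion e r)) c

subject-reduction* : ∀ {Θ t t' N n} → Star _→l_ t t' → Θ ⊩ t ∶ N # n → ∃ λ n' → n' ≤ n × Θ ⊩ t' ∶ N # n'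
subject-reduction* ε       d = _ , ≤-refl , d
subject-reduction* (r ◅ rs) d with subject-reduction d (→l⇒⟶ r)
... | _ , n₁<n , d₁ with subject-reduction* rs d₁
... | _ , n₂≤n₁ , d₂ = _ , ≤-trans n₂≤n₁ (<⇒≤ n₁<n) , d₂

subject-expansion* : ∀ {Θ t t' N} → Star _→l_ t t' → Θ ⊩ t' ∶ N → Θ ⊩ t ∶ N
subject-expansion* ε        d       = d
subject-expansion* (r ◅ rs) d with subject-expansion* rs d
... | _ , d₁ = subject-expansion d₁ (→l⇒⟶ r)

⊩⇒normalising : ∀ {Θ t N n} → Acc _<_ n → Θ ⊩ t ∶ N # n → ∃ (t ⇓l_)
⊩⇒normalising {t = t} (acc rs) d with progress t
... | inj₂ t-nf = t , ε , λ t' r → t-nf t' (→l⇒⟶ r)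
... | inj₁ (t' , r) with subject-reduction d r
... | _ , n'<n , d' with ⊩⇒normalising (rs n'<n) d'
... | n , t'⟶*n , n-nf = n , ⟶⇒→l r ◅ t'⟶*n , n-nf

-- Transfer along enf simulations

record Unplug (L : LCtx) (s : PTm) (Θ : Ctx) (M : Multi) (n : ℕ) : Set where
  constructor unplug
  field
    N        : Multi
    Γ Δ      : Ctx
    a b      : ℕ
    split    : Θ ≈ᶜ (Γ ⊎ᶜ Δ)
    ⊩s       : Δ ⊩ s ∶ N # b
    size     : n ≡ a + b
    replug   : ∀ {Δ' s' b'} → Δ' ⊩ s' ∶ N # b' → (Γ ⊎ᶜ Δ') ⊩ plug L s' ∶ M # (a + b')
    Γ-unused : ∀ z → ¬ OccursL z L → Γ z ≈ᴹ []

⊩-unplug : ∀ L {s Θ M n} → Θ ⊩ plug L s ∶ M # n → Unplug L s Θ M n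
⊩-unplug hole {Θ = Θ} {M} d = unplug M ∅ᶜ Θ 0 _ ≈ᶜ-refl d refl (λ d' → d') (λ z _ → [])
⊩-unplug (vL v _ L) (app {Γ = Γᵥ} {a = aᵥ} dv dL c) with ⊩-unplug L dL
... | unplug N Γ Δ a b split ds refl replug Γ-unused =
  unplug N (Γᵥ ⊎ᶜ Γ) Δ (suc (aᵥ + a)) b
    (≈ᶜ-trans c (≈ᶜ-trans (⊎ᶜ-cong ≈ᶜ-refl split) (≈ᶜ-sym (⊎ᶜ-assoc Γᵥ Γ Δ)))) ds
    (cong suc (≡-sym (+-assoc aᵥ a b)))
    (λ {Δ'} {b' = b'} d' → ⊩-cast (cong suc (≡-sym (+-assoc aᵥ a b'))) (app dv (replug d') (⊎ᶜ-assoc Γᵥ Γ Δ')))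
    (λ z z∉ → ++-≈ᴹ[] (not-occurs⇒≈[] (λ o → z∉ (vLv o)) dv) (Γ-unused z (λ o → z∉ (vLL o))))
⊩-unplug (Lt L t) (app {Δ = Γₜ} {b = aₜ} dL dt c) with ⊩-unplug L dL
... | unplug N Γ Δ a b split ds refl replug Γ-unused =
  unplug N (Γ ⊎ᶜ Γₜ) Δ (suc (a + aₜ)) b
    (≈ᶜ-trans c (≈ᶜ-trans (⊎ᶜ-cong split ≈ᶜ-refl) (Ctx⊎.xy∙z≈xz∙y Γ Δ Γₜ))) ds
    (cong suc (ℕ+.xy∙z≈xz∙y a b aₜ))
    (λ {Δ'} {b' = b'} d' → ⊩-cast (cong suc (ℕ+.xy∙z≈xz∙y a b' aₜ)) (app (replug d') dt (Ctx⊎.xy∙z≈xz∙y Γ Γₜ Δ')))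
    (λ z z∉ → ++-≈ᴹ[] (Γ-unused z (λ o → z∉ (LtL o))) (not-occurs⇒≈[] (λ o → z∉ (Ltt o)) dt))

TransfersBelow : ℕ → PTm → PTm → Set
TransfersBelow n t t' = ∀ {Γ M m} → m < n → Γ ⊩ t ∶ M # m → Γ ⊩ t' ∶ M

TransfersBelow-mono : ∀ {m n t t'} → m ≤ n → TransfersBelow n t t' → TransfersBelow m t t'
TransfersBelow-mono m≤n transfer k<m = transfer (<-≤-trans k<m m≤n)

lam-transfer : ∀ {t t' Θ M n} → TransfersBelow n t t' → Θ ⊩ lam t ∶ M # n → Θ ⊩ lam t' ∶ M
lam-transfer {t' = t'} transfer (nil _ c) = _ , nil (lam t') c
lam-transfer transfer (cons (abs {n = s} d) e c) =
  _ , cons (abs (proj₂ (transfer (m≤m+n (suc s) _) d)))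
           (proj₂ (lam-transfer (TransfersBelow-mono (m≤n+m _ (suc s)) transfer) e)) c

neutral-transfer : ∀ {L L' x v v' z Θ M n} → ¬ OccursL z L → ¬ OccursL z L' →
                   TransfersBelow n v v' → TransfersBelow n (plug L (var z)) (plug L' (var z)) →
                   Θ ⊩ plug L (app (var x) v) ∶ M # n → Θ ⊩ plug L' (app (var x) v') ∶ M
neutral-transfer {L} {L'} {z = z} z∉L z∉L' transfer-v transfer-Lz d with ⊩-unplug L d
... | unplug N Γ Δ a _ split (app {a = aₓ} {b = bᵥ} dx dv c) refl replug Γ-unused
  with transfer-v (≤-trans (s≤s (m≤n+m bᵥ aₓ)) (m≤n+m _ a)) dv
     | transfer-Lz (+-monoʳ-< a (s≤s z≤n)) (replug (⊩-var⁺ {x = z} N ≈ᶜ-refl))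
... | _ , dv' | _ , dLz with ⊩-unplug L' dLz
... | unplug N' Γ' _ _ _ split' dz _ replug' Γ'-unused with ⊩-var⁻ dz
... | Δ'≈z , _ with ⊎ᶜ-singleᶜ-cancel z (≈ᶜ-trans split' (⊎ᶜ-cong ≈ᶜ-refl Δ'≈z)) (Γ-unused z z∉L) (Γ'-unused z z∉L')
... | Γ≈Γ' , N≈N' =
  _ , ⊩-≈ᶜ (≈ᶜ-sym (≈ᶜ-trans split (⊎ᶜ-cong Γ≈Γ' ≈ᶜ-refl))) (replug' (⊩-≈ᴹ (app dx dv' c) N≈N'))

transfer-via-reducts : ∀ {t t' u u' Γ M n} → Star _→l_ t u → Star _→l_ t' u' →
                       (∀ {m} → m ≤ n → Γ ⊩ u ∶ M # m → Γ ⊩ u' ∶ M) →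
                       Γ ⊩ t ∶ M # n → Γ ⊩ t' ∶ M
transfer-via-reducts t⟶*u t'⟶*u' transfer d with subject-reduction* t⟶*u d
... | _ , m≤n , du = subject-expansion* t'⟶*u' (transfer m≤n du)

enfSim-step : ∀ {R n t t' Γ M} → IsEnfSim R → (∀ {s s'} → R s s' → TransfersBelow n s s') →
              R t t' → Γ ⊩ t ∶ M # n → Γ ⊩ t' ∶ M
enfSim-step {n = n} {t} {t'} sim transfer r d with sim t t' r
... | inj₁ diverges = ⊥-elim (diverges (⊩⇒normalising (<-wellFounded n) d))
... | inj₂ (inj₁ (_ , (t⟶*x , _) , (t'⟶*x , _))) =
  transfer-via-reducts t⟶*x t'⟶*x (λ _ dx → _ , dx) d
... | inj₂ (inj₂ (inj₁ (_ , _ , (t⟶*λ , _) , (t'⟶*λ , _) , r-body))) =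
  transfer-via-reducts t⟶*λ t'⟶*λ
    (λ m≤n → lam-transfer (TransfersBelow-mono m≤n (transfer r-body))) d
... | inj₂ (inj₂ (inj₂ (_ , _ , _ , _ , _ , _ , _ , (t⟶*L , _) , (t'⟶*L' , _) , r-arg , z , z∉L , z∉L' , r-ctx))) =
  transfer-via-reducts t⟶*L t'⟶*L'
    (λ m≤n → neutral-transfer z∉L z∉L' (TransfersBelow-mono m≤n (transfer r-arg))
                                       (TransfersBelow-mono m≤n (transfer r-ctx))) d

enfSim-transfer : ∀ {R t t' Γ M n} → IsEnfSim R → Acc _<_ n → R t t' → Γ ⊩ t ∶ M # n → Γ ⊩ t' ∶ M
enfSim-transfer sim (acc rs) = enfSim-step sim (λ r k<n → enfSim-transfer sim (rs k<n) r)

-- Agreement with _⊢_∶_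

≈ᶜ-singleᶜ⁺ : ∀ {Γ} x {N} → Γ x ≈ᴹ N → (∀ y → y ≢ x → Γ y ≈ᴹ []) → Γ ≈ᶜ singleᶜ x N
≈ᶜ-singleᶜ⁺ x {N} Γx≈N others y with y ≟ x
... | yes refl = trans Γx≈N (≈ᴹ-reflexive (≡-sym (singleᶜ-self x N)))
... | no y≢x   = trans (others y y≢x) (≈ᴹ-reflexive (≡-sym (singleᶜ-≢ x N y≢x)))

≈ᶜ-singleᶜ⁻ : ∀ {Γ} x {N} → Γ ≈ᶜ singleᶜ x N → Γ x ≈ᴹ N × (∀ y → y ≢ x → Γ y ≈ᴹ [])
≈ᶜ-singleᶜ⁻ x {N} c = trans (c x) (≈ᴹ-reflexive (singleᶜ-self x N)) ,
                      λ y y≢x → trans (c y) (≈ᴹ-reflexive (singleᶜ-≢ x N y≢x))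

isVal⇒isValT : ∀ {v} → IsVal v → IsValT ⌜ v ⌝
isVal⇒isValT (var x) = var x
isVal⇒isValT (lam t) = lam ⌜ t ⌝

⊢⇒⊩      : ∀ t {Γ M} → Γ ⊢ ⌜ t ⌝ ∶ M → Γ ⊩ t ∶ M
⊢ₗ⇒⊩ₗ    : ∀ t {Γ L} → Γ ⊢ₗ ⌜ t ⌝ ∶ L → ∃ (Γ ⊩ₗ t ∶ L #_)
⊢-many⇒⊩ : ∀ v {Θ M} → IsVal v → (ds : List (Ctx × Lin)) → All (λ d → proj₁ d ⊢ₗ ⌜ v ⌝ ∶ proj₂ d) ds →
           Θ ≈ᶜ ⨄ (map proj₁ ds) → M ≈ᴹ map proj₂ ds → Θ ⊩ v ∶ M
⊢⇒⊩ (var x)   (many _ ds ⊢ds c e) = ⊢-many⇒⊩ (var x) (var x) ds ⊢ds c e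
⊢⇒⊩ (lam t)   (many _ ds ⊢ds c e) = ⊢-many⇒⊩ (lam t) (lam t) ds ⊢ds c e
⊢⇒⊩ (app t u) (app d e c)         = _ , app (proj₂ (⊢⇒⊩ t d)) (proj₂ (⊢⇒⊩ u e)) c
⊢ₗ⇒⊩ₗ (var x) (ax Γx≈L others) = 0 , ax (≈ᶜ-singleᶜ⁺ x Γx≈L others)
⊢ₗ⇒⊩ₗ (lam t) (abs d)          = _ , abs (proj₂ (⊢⇒⊩ t d))
⊢-many⇒⊩ v val []             []          c e  = 0 , ⊩-≈ᴹ (nil val c) (≈ᴹ-sym e)
⊢-many⇒⊩ v val ((Γ , L) ∷ ds) (d ∷ ⊢ds) c e  =
  _ , ⊩-≈ᴹ (cons (proj₂ (⊢ₗ⇒⊩ₗ v d)) (proj₂ (⊢-many⇒⊩ v val ds ⊢ds ≈ᶜ-refl ≈ᴹ-refl)) c) (≈ᴹ-sym e)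

⊩⇒⊢           : ∀ {Γ t M n} → Γ ⊩ t ∶ M # n → Γ ⊢ ⌜ t ⌝ ∶ M
⊩ₗ⇒⊢ₗ         : ∀ {Γ t L n} → Γ ⊩ₗ t ∶ L # n → Γ ⊢ₗ ⌜ t ⌝ ∶ L
⊩-value⇒All-⊢ₗ : ∀ {Θ v M n} → IsVal v → Θ ⊩ v ∶ M # n →
                ∃ λ (ds : List (Ctx × Lin)) → All (λ d → proj₁ d ⊢ₗ ⌜ v ⌝ ∶ proj₂ d) ds ×
                  Θ ≈ᶜ ⨄ (map proj₁ ds) × M ≡ map proj₂ ds
⊩⇒⊢ (app d e c) = app (⊩⇒⊢ d) (⊩⇒⊢ e) c
⊩⇒⊢ d@(nil val _) with ⊩-value⇒All-⊢ₗ val d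
... | ds , ⊢ds , c , M≡ = many (isVal⇒isValT val) ds ⊢ds c (≈ᴹ-reflexive M≡)
⊩⇒⊢ d@(cons dₗ _ _) with ⊩-value⇒All-⊢ₗ (⊩ₗ-isVal dₗ) d
... | ds , ⊢ds , c , M≡ = many (isVal⇒isValT (⊩ₗ-isVal dₗ)) ds ⊢ds c (≈ᴹ-reflexive M≡)
⊩ₗ⇒⊢ₗ (ax {x = x} c) = let Γx≈L , others = ≈ᶜ-singleᶜ⁻ x c in ax Γx≈L others
⊩ₗ⇒⊢ₗ (abs d)        = abs (⊩⇒⊢ d)
⊩-value⇒All-⊢ₗ val (nil _ c) = [] , [] , c , refl
⊩-value⇒All-⊢ₗ val (cons {Γ = Γ} {L = L} d e c) with ⊩-value⇒All-⊢ₗ val e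
... | ds , ⊢ds , c' , refl = (Γ , L) ∷ ds , ⊩ₗ⇒⊢ₗ d ∷ ⊢ds , ≈ᶜ-trans c (⊎ᶜ-cong ≈ᶜ-refl c') , refl
⊩-value⇒All-⊢ₗ () (app _ _ _)

enfSim⇒typing-preserved : (R : PTm → PTm → Set) → IsEnfSim R →
                          ∀ t t' → R t t' → ∀ (Γ : Ctx) (M : Multi) → Γ ⊢ ⌜ t ⌝ ∶ M → Γ ⊢ ⌜ t' ⌝ ∶ M
enfSim⇒typing-preserved R sim t t' r Γ M d =
  ⊩⇒⊢ (proj₂ (enfSim-transfer sim (<-wellFounded _) r (proj₂ (⊢⇒⊩ t d))))

proposition12p7 : ((R : PTm → PTm → Set) → IsEnfSim R →
                     ∀ t t' → R t t' → ∀ (Γ : Ctx) (M : Multi) →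
                     Γ ⊢ ⌜ t ⌝ ∶ M → Γ ⊢ ⌜ t' ⌝ ∶ M)
                  × (∀ t t' → t ≾enf t' → t ≾type t')
proposition12p7 =
  enfSim⇒typing-preserved ,
  λ { t t' (R , sim , r) → enfSim⇒typing-preserved R sim t t' r }
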